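{- For every positive integer $k$ there exist a binary matrix $A_k$ and binary column vectors $x_1,\dots,x_k$ such that $R_{bool}(A_k|x_i)=R_{bool}(A_k)=4$ for every $1\le i\le k$, but $R_{bool}(A_k|x_1,\dots,x_k)\ge k$.
   Context: A binary matrix has entries in $\{0,1\}$. The boolean rank $R_{bool}(A)$ of an $n\times m$ binary matrix $A$ is the minimal $k$ such that $A=U\cdot V$ with $U$ an $n\times k$ and $V$ a $k\times m$ binary matrix, where the product uses boolean arithmetic ($1+1=1$). $(A|x_1,\dots,x_t)$ denotes $A$ with the column vectors $x_1,\dots,x_t$ appended as additional columns. -}

module Defs where

open import Data.Nat using (ℕ; _+_; _<_)
open import Data.Fin using (Fin; splitAt)
open import Data.Bool using (Bool; _∧_; _∨_; false)
open import Data.Sum using (inj₁; inj₂)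
open import Data.Product using (Σ; _×_)
open import Relation.Binary.PropositionalEquality using (_≡_)
open import Relation.Nullary using (¬_)

Matrix : ℕ → ℕ → Set
Matrix n m = Fin n → Fin m → Bool

Column : ℕ → Set
Column n = Fin n → Bool

bigOr : (k : ℕ) → (Fin k → Bool) → Bool
bigOr ℕ.zero    f = false
bigOr (ℕ.suc k) f = f Fin.zero ∨ bigOr k (λ j → f (Fin.suc j))

_⊙_ : ∀ {n k m} → Matrix n k → Matrix k m → Matrix n m
_⊙_ {k = k} U V i j = bigOr k (λ l → U i l ∧ V l j)

HasBoolFactorization : ∀ {n m} → Matrix n m → ℕ → Set
HasBoolFactorization {n} {m} A k =
  Σ (Matrix n k) λ U → Σ (Matrix k m) λ V → (∀ i j → A i j ≡ (U ⊙ V) i j)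

BoolRankIs : ∀ {n m} → Matrix n m → ℕ → Set
BoolRankIs A r = HasBoolFactorization A r × (∀ k → k < r → ¬ HasBoolFactorization A k)

appendCols : ∀ {n m t} → Matrix n m → (Fin t → Column n) → Matrix n (m + t)
appendCols {m = m} A xs i j with splitAt m j
... | inj₁ j' = A i j'
... | inj₂ l  = xs l i

appendCol : ∀ {n m} → Matrix n m → Column n → Matrix n (m + 1)
appendCol A x = appendCols A (λ _ → x)

-- C₄ has ones exactly at (i, i) and (i, i + 1 mod 4); its diagonal is a fooling set, so every
-- matrix containing C₄ has boolean rank at least 4.  Aₖ is C₄ stacked on k rows of ones.  The
-- all-ones row is covered both by rows 0 and 2 of C₄ and by rows 1 and 3, and only the first
-- pair uses factor 0.  Hence appending a column that is e₀ on the C₄ part keeps the rank at 4: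
-- factor 0 also produces the new column, and each all-ones row picks its covering pair
-- according to its new entry.  The columns e₀ stacked on the k unit vectors are thus harmless
-- one at a time, but together they contain a k × k identity matrix, whose diagonal is again a
-- fooling set.
module Submission where

open import Defs
open import Data.Bool using (Bool; true; false; not; _∧_; _∨_)
open import Data.Bool.Properties using (∧-conicalˡ; ∧-conicalʳ; ∨-zeroʳ; ∨-identityʳ)
  renaming (_≟_ to _≟ᴮ_)
open import Data.Fin using (Fin; zero; suc; splitAt; _↑ˡ_; _↑ʳ_)
open import Data.Fin.Properties using (_≟_; all?; injective⇒≤; splitAt-↑ˡ)
open import Data.Nat using (ℕ; zero; suc; _+_; _≤_; _<_)
open import Data.Nat.Properties using (≤⇒≯)
open import Data.Product using (Σ; _×_; _,_; proj₁; proj₂)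
open import Data.Sum using (inj₁; inj₂)
open import Data.Vec using (Vec; []; _∷_; lookup)
open import Data.Vec.Functional using (_++_)
open import Data.Vec.Functional.Properties using (lookup-++ˡ)
open import Function using (_∘_; id; _$_)
open import Relation.Binary.PropositionalEquality using (_≡_; _≗_; refl; sym; trans; cong; cong₂; subst)
open import Relation.Nullary.Decidable using (yes; no; does; True; toWitness; from-yes; dec-true; _→-dec_)

decide-≗ : ∀ {n} {f g : Fin n → Bool} → {proof : True (all? λ i → f i ≟ᴮ g i)} → f ≗ g
decide-≗ {proof = p} = toWitness p

bigOr-witness : ∀ k (f : Fin k → Bool) → bigOr k f ≡ true → Σ (Fin k) λ l → f l ≡ true
bigOr-witness (suc k) f eq with f zero in f0
... | true  = zero , f0
... | false = let l , fl = bigOr-witness k (f ∘ suc) eq in suc l , fl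

bigOr-intro : ∀ k (f : Fin k → Bool) l → f l ≡ true → bigOr k f ≡ true
bigOr-intro (suc k) f zero    fl rewrite fl = refl
bigOr-intro (suc k) f (suc l) fl = trans (cong (f zero ∨_) (bigOr-intro k (f ∘ suc) l fl)) (∨-zeroʳ _)

bigOr-false : ∀ k → bigOr k (λ _ → false) ≡ false
bigOr-false zero    = refl
bigOr-false (suc k) = bigOr-false k

infix 4 _≋_ _⊑_

_≋_ : ∀ {n m} → Matrix n m → Matrix n m → Set
M ≋ N = ∀ i j → M i j ≡ N i j

col : ∀ {n m} → Matrix n m → Fin m → Column n
col M j i = M i j

𝟙 : ∀ {n} → Matrix n n
𝟙 i j = does (i ≟ j)

𝟙-true⇒≡ : ∀ {n} {i j : Fin n} → 𝟙 i j ≡ true → i ≡ j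
𝟙-true⇒≡ {i = i} {j} with i ≟ j
... | yes i≡j = λ _ → i≡j
... | no  _   = λ ()

⊙-identityˡ : ∀ {n m} (M : Matrix n m) → 𝟙 ⊙ M ≋ M
⊙-identityˡ {suc n} M zero    j = trans (cong (M zero j ∨_) (bigOr-false n)) (∨-identityʳ _)
⊙-identityˡ {suc n} M (suc i) j = ⊙-identityˡ (M ∘ suc) i j

++-⊙ : ∀ {n n′ k m} {T : Matrix n m} {B : Matrix n′ m} {U : Matrix n k} {U′ : Matrix n′ k}
         {V : Matrix k m} → T ≋ U ⊙ V → B ≋ U′ ⊙ V → T ++ B ≋ (U ++ U′) ⊙ V
++-⊙ {n} T≋ B≋ i j with splitAt n i
... | inj₁ i′ = T≋ i′ j
... | inj₂ i′ = B≋ i′ j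

appendCols-row : ∀ {n m t} (M : Matrix n m) (xs : Fin t → Column n) i →
                 appendCols M xs i ≗ M i ++ (λ l → xs l i)
appendCols-row {m = m} M xs i j with splitAt m j
... | inj₁ _ = refl
... | inj₂ _ = refl

appendCols-↑ˡ : ∀ {n m t} (M : Matrix n m) (xs : Fin t → Column n) i j →
                appendCols M xs i (j ↑ˡ t) ≡ M i j
appendCols-↑ˡ {m = m} {t} M xs i j rewrite splitAt-↑ˡ m j t = refl

appendCols-++ : ∀ {n n′ m t} (T : Matrix n m) (B : Matrix n′ m)
                (ts : Fin t → Column n) (bs : Fin t → Column n′) →
                appendCols (T ++ B) (λ l → ts l ++ bs l) ≋ appendCols T ts ++ appendCols B bs
appendCols-++ {n} T B ts bs i j rewrite appendCols-row (T ++ B) (λ l → ts l ++ bs l) i j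
  with splitAt n i
... | inj₁ i′ = sym (appendCols-row T ts i′ j)
... | inj₂ i′ = sym (appendCols-row B bs i′ j)

_⊑_ : ∀ {s t n m} → Matrix s t → Matrix n m → Set
_⊑_ {s} {t} {n} {m} N M =
  Σ (Fin s → Fin n) λ rows → Σ (Fin t → Fin m) λ cols → ∀ a b → N a b ≡ M (rows a) (cols b)

⊑-factorization : ∀ {s t n m r} {N : Matrix s t} {M : Matrix n m} →
                  N ⊑ M → HasBoolFactorization M r → HasBoolFactorization N r
⊑-factorization (rows , cols , N≡M) (U , V , M≋UV) =
  U ∘ rows , (λ l → V l ∘ cols) , λ a b → trans (N≡M a b) (M≋UV (rows a) (cols b))

⊑-appendCols : ∀ {n m t} (M : Matrix n m) (xs : Fin t → Column n) → M ⊑ appendCols M xs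
⊑-appendCols {t = t} M xs = id , (_↑ˡ t) , λ a b → sym (appendCols-↑ˡ M xs a b)

boolRankIs : ∀ {n m r} {M : Matrix n m} →
             HasBoolFactorization M r → (∀ s → HasBoolFactorization M s → r ≤ s) → BoolRankIs M r
boolRankIs factorization lower = factorization , λ s s<r h → ≤⇒≯ (lower s h) s<r

-- Distinct fooling-set entries cannot share a rank-one factor.
fooling-set⇒≤ : ∀ {s r} (F : Matrix s s) →
                (∀ a → F a a ≡ true) → (∀ a b → F a b ∧ F b a ≡ true → a ≡ b) →
                HasBoolFactorization F r → s ≤ r
fooling-set⇒≤ {s} {r} F diagonal fooling (U , V , F≋UV) = injective⇒≤ factor-injective
  where
  witness : ∀ a → Σ (Fin r) λ l → U a l ∧ V l a ≡ true
  witness a = bigOr-witness r _ (trans (sym (F≋UV a a)) (diagonal a))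

  factor : Fin s → Fin r
  factor a = proj₁ (witness a)

  shared-factor⇒true : ∀ {a b} → factor a ≡ factor b → F a b ≡ true
  shared-factor⇒true {a} {b} same = trans (F≋UV a b) (bigOr-intro r _ (factor a) (cong₂ _∧_ Ua Vb))
    where
    Ua : U a (factor a) ≡ true
    Ua = ∧-conicalˡ _ _ (proj₂ (witness a))
    Vb : V (factor a) b ≡ true
    Vb = subst (λ l → V l b ≡ true) (sym same) (∧-conicalʳ _ _ (proj₂ (witness b)))

  factor-injective : ∀ {a b} → factor a ≡ factor b → a ≡ b
  factor-injective {a} {b} same =
    fooling a b (cong₂ _∧_ (shared-factor⇒true same) (shared-factor⇒true (sym same)))

𝟙-rank-≥ : ∀ {k r} → HasBoolFactorization (𝟙 {k}) r → k ≤ r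
𝟙-rank-≥ = fooling-set⇒≤ 𝟙 (λ a → dec-true (a ≟ a) refl) (λ a b → 𝟙-true⇒≡ ∘ ∧-conicalˡ _ _)

C₄ : Matrix 4 4
C₄ i j = lookup (lookup rows i) j
  where
  rows : Vec (Vec Bool 4) 4
  rows = (true  ∷ true  ∷ false ∷ false ∷ [])
       ∷ (false ∷ true  ∷ true  ∷ false ∷ [])
       ∷ (false ∷ false ∷ true  ∷ true  ∷ [])
       ∷ (true  ∷ false ∷ false ∷ true  ∷ [])
       ∷ []

C₄-rank-≥ : ∀ {r} → HasBoolFactorization C₄ r → 4 ≤ r
C₄-rank-≥ = fooling-set⇒≤ C₄ decide-≗
  (from-yes (all? λ a → all? λ b → (C₄ a b ∧ C₄ b a ≟ᴮ true) →-dec (a ≟ b)))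

e₀ : Column 4
e₀ = col 𝟙 zero

V : Matrix 4 5
V = appendCol C₄ e₀

cover : Bool → Fin 4 → Bool
cover b = lookup (b ∷ not b ∷ b ∷ not b ∷ [])

ones-then : Bool → Fin (4 + 1) → Bool
ones-then b = (λ (_ : Fin 4) → true) ++ (λ (_ : Fin 1) → b)

cover-factorization : ∀ b → ones-then b ≗ (λ c → bigOr 4 (λ l → cover b l ∧ V l c))
cover-factorization true  = decide-≗
cover-factorization false = decide-≗

module _ (k : ℕ) where

  ones : Matrix k 4
  ones _ _ = true

  A : Matrix (4 + k) 4
  A = C₄ ++ ones

  x : Fin k → Column (4 + k)
  x a = e₀ ++ col 𝟙 a

  C₄⊑A : C₄ ⊑ A
  C₄⊑A = (_↑ˡ k) , id , λ a b → sym (cong (_$ b) (lookup-++ˡ C₄ _ a))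

  A-rank-≥ : ∀ {r} → HasBoolFactorization A r → 4 ≤ r
  A-rank-≥ = C₄-rank-≥ ∘ ⊑-factorization C₄⊑A

  A|e₀-factorization : (y : Column k) → HasBoolFactorization (appendCol A (e₀ ++ y)) 4
  A|e₀-factorization y = 𝟙 ++ (cover ∘ y) , V , λ i j →
    trans (appendCols-++ {t = 1} C₄ ones (λ _ → e₀) (λ _ → y) i j) (++-⊙ {V = V} top bottom i j)
    where
    top : appendCol C₄ e₀ ≋ 𝟙 ⊙ V
    top i j = sym (⊙-identityˡ V i j)
    bottom : appendCol ones y ≋ (cover ∘ y) ⊙ V
    bottom i j = trans (appendCols-row {t = 1} ones (λ _ → y) i j) (cover-factorization (y i) j)

  A-factorization : HasBoolFactorization A 4
  A-factorization = ⊑-factorization (⊑-appendCols A _) (A|e₀-factorization (λ _ → true))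

  𝟙⊑A|x : 𝟙 ⊑ appendCols A x
  𝟙⊑A|x = (4 ↑ʳ_) , (4 ↑ʳ_) , λ _ _ → refl

theorem6 : (k : ℕ) → 0 < k →
    Σ ℕ λ n → Σ ℕ λ m → Σ (Matrix n m) λ A → Σ (Fin k → Column n) λ xs →
      ((i : Fin k) → BoolRankIs (appendCol A (xs i)) 4)
      × BoolRankIs A 4
      × ((r : ℕ) → HasBoolFactorization (appendCols A xs) r → k ≤ r)
theorem6 k _ = 4 + k , 4 , A k , x k ,
  (λ a → boolRankIs (A|e₀-factorization k (col 𝟙 a))
                    (λ _ → A-rank-≥ k ∘ ⊑-factorization (⊑-appendCols (A k) _))) ,
  boolRankIs (A-factorization k) (λ _ → A-rank-≥ k) ,
  (λ _ → 𝟙-rank-≥ ∘ ⊑-factorization (𝟙⊑A|x k))
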